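{- Let $d\ge 1$ be an integer, $r$ a power of $2$, and let $G_d=(V_d,E_d)$ with critical path set $P_d$ be as defined below, with $\ell=dr+1$ layers. Then: (1) every critical path $\pi\in P_d$ is the unique path in $G_d$ between its endpoints; (2) any two distinct critical paths in $P_d$ associated with the same tuple $(s_1,\dots,s_d)$ (hence with distinct starting vertices) are vertex-disjoint; (3) there is a constant $K_d$ depending only on $d$ such that for every path $\sigma$ in $G_d$ of length $g\ge1$ from a vertex in layer $a$ to a vertex in layer $b$, where $a,b\in\langle\ell\rangle$ and $b-a=g$, at most $K_d\,(r/g)^d$ critical paths in $P_d$ contain $\sigma$ as a subpath.
   Context: For a nonnegative integer $N$, $\langle N\rangle=\{0,\dots,N-1\}$ and $[N]=\{1,\dots,N\}$. Let $q$ be the permutation of $\langle r\rangle$ such that the $(\log_2 r)$-bit binary representation of $q_i$ is that of $i$ reversed. Let $e_1,\dots,e_{d+1}$ be the standard basis vectors of $\mathbb{Z}^{d+1}$. For $k\in\{1,\dots,d\}$ and $i\in\langle r\rangle$ put $\vec w_{id+k-1}=e_k+q_i e_{d+1}$; so $\vec w_0,\dots,\vec w_{dr-1}$ enumerate $W=\{e_k+j e_{d+1}: k\in[d], j\in\langle r\rangle\}$. The graph $G_d$ has vertex set $\{(i,\vec x): i\in\{0,\dots,dr\},\ \vec x\in\langle 2dr\rangle^d\times\langle 2dr^2\rangle\}$ ($i$ is the layer). For $i\in\langle dr\rangle$ let $E_i=\{\vec w_i,\vec 0\}$; for every vertex $(i,\vec x)$ with $i<dr$ and every $\vec e\in E_i$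 with $\vec x+\vec e\in\langle 2dr\rangle^d\times\langle 2dr^2\rangle$ there is an edge from $(i,\vec x)$ to $(i+1,\vec x+\vec e)$; there are no other edges. For each $\vec x\in\langle r\rangle^d\times\langle r^2\rangle$ and each $(s_1,\dots,s_d)\in[r]^d$, let $T=\bigcup_{k=1}^d\{e_k+je_{d+1}: j\in\langle s_k\rangle\}$; the critical path associated with $\vec x$ and $(s_1,\dots,s_d)$ starts at $(0,\vec x)$ and, from layer $i$ to layer $i+1$, uses the edge corresponding to $\vec w_i$ if $\vec w_i\in T$ and the edge corresponding to $\vec 0$ otherwise. $P_d$ is the set of all critical paths. -}

module Defs where

open import Data.Nat using (ℕ; zero; suc; _+_; _*_; _^_; _≤_; _<_; NonZero)
open import Data.Nat.DivMod using (_/_; _mod_; _%_)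
open import Data.Fin using (Fin)
import Data.Fin as F
open import Data.Vec using (Vec; []; _∷_; replicate; zipWith; lookup)
open import Data.Vec.Relation.Unary.All using (All)
open import Data.List using (List; []; _∷_)
open import Data.Product using (Σ; _×_; _,_)
open import Data.Sum using (_⊎_)
open import Relation.Nullary using (¬_)
open import Data.Empty using (⊥)
open import Relation.Binary.PropositionalEquality using (_≡_)

-- Bit reversal: rev m i = number whose m-bit binary representation is that
-- of i (written with m bits) reversed.  q_i = rev m i where r = 2^m.
rev : ℕ → ℕ → ℕ
rev zero    i = 0
rev (suc m) i = (i % 2) * 2 ^ m + rev m (i / 2)

unitV : (n : ℕ) → Fin n → Vec ℕ n
unitV (suc n) F.zero    = 1 ∷ replicate n 0
unitV (suc n) (F.suc k) = 0 ∷ unitV n k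

data _[_]=_ {A : Set} : List A → ℕ → A → Set where
  here  : ∀ {x xs} → (x ∷ xs) [ 0 ]= x
  there : ∀ {x xs i y} → xs [ i ]= y → (x ∷ xs) [ suc i ]= y

-- Points of ℤ^{d+1} (here with ℕ entries) are pairs (first d coordinates, last coordinate).
Point : ℕ → Set
Point d = Vec ℕ d × ℕ

_⊕_ : ∀ {d} → Point d → Point d → Point d
(xs , z) ⊕ (ys , u) = (zipWith _+_ xs ys , z + u)

𝟎 : ∀ {d} → Point d
𝟎 {d} = (replicate d 0 , 0)

module Construction (d : ℕ) .{{_ : NonZero d}} (m : ℕ) where

  r : ℕ
  r = 2 ^ m

  q : ℕ → ℕ
  q i = rev m i

  -- w_t for t = i·d + k - 1 (k ∈ [d]) is e_k + q_i e_{d+1};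
  -- here the Fin d index (t mod d) corresponds to k - 1 and i = t / d.
  w : ℕ → Point d
  w t = (unitV d (t mod d) , q (t / d))

  InVBox : Point d → Set
  InVBox (xs , z) = All (λ c → c < 2 * d * r) xs × z < 2 * d * r * r

  InStart : Point d → Set
  InStart (xs , z) = All (λ c → c < r) xs × z < r * r

  InTuple : Vec ℕ d → Set
  InTuple s = All (λ c → 1 ≤ c × c ≤ r) s

  InT : Vec ℕ d → Point d → Set
  InT s v = Σ (Fin d) λ k → Σ ℕ λ j → j < lookup s k × v ≡ (unitV d k , j)

  -- A (directed) path in G_d: its start layer a and its list of points
  -- (the vertex at position t is (a + t, point)).
  data IsPathFrom : ℕ → List (Point d) → Set where
    single : ∀ {a x} → a ≤ d * r → InVBox x → IsPathFrom a (x ∷ [])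
    cons   : ∀ {a x y ps} → InVBox x → (y ≡ x ⊕ w a ⊎ y ≡ x ⊕ 𝟎) →
             IsPathFrom (suc a) (y ∷ ps) → IsPathFrom a (x ∷ y ∷ ps)

  data CritFrom (s : Vec ℕ d) : ℕ → List (Point d) → Set where
    end  : ∀ {t x} → t ≡ d * r → CritFrom s t (x ∷ [])
    step : ∀ {t x y ps} → (InT s (w t) → y ≡ x ⊕ w t) → (¬ InT s (w t) → y ≡ x ⊕ 𝟎) →
           CritFrom s (suc t) (y ∷ ps) → CritFrom s t (x ∷ y ∷ ps)

  CritPath : Point d → Vec ℕ d → List (Point d) → Set
  CritPath x s π = InStart x × InTuple s × π [ 0 ]= x × CritFrom s 0 π

  InP : List (Point d) → Set
  InP π = Σ (Point d) λ x → Σ (Vec ℕ d) λ s → CritPath x s π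

  SubpathAt : ℕ → List (Point d) → List (Point d) → Set
  SubpathAt a σ π = ∀ t p → σ [ t ]= p → π [ a + t ]= p

  VertexDisjoint : List (Point d) → List (Point d) → Set
  VertexDisjoint π π' = ∀ i p → π [ i ]= p → π' [ i ]= p → ⊥

{-# OPTIONS --safe #-}
-- For a tuple s let Φ_s(x) = 2z + Σ_k x_k − 2 Σ_k s_k x_k.  The edge w_t, t = id + k − 1, changes Φ_s
-- by 2q_i + 1 − 2s_k, which is negative exactly when w_t ∈ T: every step of a critical path strictly
-- minimises the increase of Φ_s.  Since Φ_s is additive, all paths between two vertices increase it
-- by the same amount, so a path sharing the endpoints of a critical path takes its step at every
-- layer (1).  Critical paths for one tuple are determined by any of their vertices, forwards by the
-- rule and backwards by cancellation (2).  For (3), the critical paths containing σ take the same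
-- decision at each of the g layers of σ.  Choose j with 2^{j+1}d ≤ g ≤ 2^{j+2}d and r = 2^j·2^l;
-- those layers contain 2^j consecutive blocks i, and the top j bits of q_i are the reversed low j
-- bits of i, so the values q_i meet every interval [p 2^l, (p+1) 2^l).  Hence the tuples of these
-- paths differ by less than 2^{l+1} in each coordinate, there are at most (4·2^l)^d of them, each
-- determines its path, and g^d ≤ (4·2^j d)^d gives the bound with K_d = (16d)^d.
module Submission where

open import Defs
open import Data.Nat using (ℕ; suc; _*_; _^_; _≤_; _∸_; NonZero)
open import Data.List using (List; length)
open import Data.List.Relation.Unary.All using (All)
open import Data.List.Relation.Unary.Unique.Propositional using (Unique)
open import Data.Vec using (Vec)
open import Data.Product using (Σ; _×_)
open import Relation.Nullary using (¬_)
open import Relation.Binary.PropositionalEquality using (_≡_)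

open import Data.Nat using (zero; _+_; _<_; z≤n; s≤s; _<?_; _≤?_)
open import Data.Nat.Properties
open import Data.Fin as F using (Fin; toℕ; fromℕ<; funToFin; finToFun)
import Data.Fin.Properties as Finₚ
open import Data.Vec using ([]; _∷_; zipWith; replicate; lookup; map; tabulate)
import Data.Vec.Properties as Vecₚ
open import Data.Vec.Relation.Unary.All as VecAll using ([]; _∷_) renaming (All to VecAll)
import Data.Vec.Relation.Unary.All.Properties as VecAllₚ
import Data.List as List
open import Data.List using ([]; _∷_)
import Data.List.Relation.Unary.All as AllL
open AllL using ([]; _∷_)
open import Data.List.Relation.Unary.AllPairs using (_∷_)
open import Data.List.Membership.Propositional.Properties using (∈-lookup)
open import Data.Product using (_,_; proj₁; proj₂; ∃-syntax)
open import Data.Empty using (⊥; ⊥-elim)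
open import Relation.Nullary using (Dec; yes; no)
open import Relation.Nullary.Decidable using (map′)
open import Function using (_∘_)
open import Relation.Binary.PropositionalEquality
  using (refl; sym; trans; cong; cong₂; subst; subst₂; module ≡-Reasoning)
open import Data.Nat.Tactic.RingSolver using (solve-∀)
open import Data.Nat.DivMod using (_/_; _%_; _mod_)
import Data.Nat.DivMod as DivMod
open import Data.Sum as Sum using (_⊎_; inj₁; inj₂)
open import Data.Integer as ℤ using (ℤ; _⊖_; 0ℤ)
import Data.Integer.Properties as ℤₚ
import Data.Integer.Tactic.RingSolver as ℤSolver

zipWith-+-cancelˡ : ∀ {n} (xs ys zs : Vec ℕ n) → zipWith _+_ xs ys ≡ zipWith _+_ xs zs → ys ≡ zs
zipWith-+-cancelˡ [] [] [] _ = refl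
zipWith-+-cancelˡ (x ∷ xs) (y ∷ ys) (z ∷ zs) eq =
  cong₂ _∷_ (+-cancelˡ-≡ x y z (Vecₚ.∷-injectiveˡ eq))
            (zipWith-+-cancelˡ xs ys zs (Vecₚ.∷-injectiveʳ eq))

⊕-comm : ∀ {n} (x y : Point n) → x ⊕ y ≡ y ⊕ x
⊕-comm (xs , z) (ys , u) = cong₂ _,_ (Vecₚ.zipWith-comm +-comm xs ys) (+-comm z u)

⊕-cancelˡ : ∀ {n} (x u v : Point n) → x ⊕ u ≡ x ⊕ v → u ≡ v
⊕-cancelˡ (xs , z) (us , a) (vs , b) eq =
  cong₂ _,_ (zipWith-+-cancelˡ xs us vs (cong proj₁ eq)) (+-cancelˡ-≡ z a b (cong proj₂ eq))

⊕-cancelʳ : ∀ {n} (x y v : Point n) → x ⊕ v ≡ y ⊕ v → x ≡ y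
⊕-cancelʳ x y v eq = ⊕-cancelˡ v x y (trans (⊕-comm v x) (trans eq (⊕-comm y v)))

unitV-injective : ∀ n {k k′ : Fin n} → unitV n k ≡ unitV n k′ → k ≡ k′
unitV-injective (suc n) {F.zero}  {F.zero}   eq = refl
unitV-injective (suc n) {F.suc k} {F.suc k′} eq = cong F.suc (unitV-injective n (Vecₚ.∷-injectiveʳ eq))

unitV≢0 : ∀ n (k : Fin n) → unitV n k ≡ replicate n 0 → ⊥
unitV≢0 (suc n) F.zero ()
unitV≢0 (suc n) (F.suc k) eq = unitV≢0 n k (Vecₚ.∷-injectiveʳ eq)

replicate-≤ : ∀ n {x B} → x ≤ B → VecAll (_≤ B) (replicate n x)
replicate-≤ zero x≤ = []
replicate-≤ (suc n) x≤ = x≤ ∷ replicate-≤ n x≤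

unitV-≤1 : ∀ n (k : Fin n) → VecAll (_≤ 1) (unitV n k)
unitV-≤1 (suc n) F.zero = s≤s z≤n ∷ replicate-≤ n z≤n
unitV-≤1 (suc n) (F.suc k) = z≤n ∷ unitV-≤1 n k

zipWith-+-< : ∀ {n B} {xs us : Vec ℕ n} → VecAll (_< B) xs → VecAll (_≤ 1) us →
              VecAll (_< suc B) (zipWith _+_ xs us)
zipWith-+-< [] [] = []
zipWith-+-< {B = B} {x ∷ _} {u ∷ _} (x< ∷ xs<) (u≤ ∷ us≤) =
  subst (_≤ suc B) (+-comm u (suc x)) (+-mono-≤ u≤ x<) ∷ zipWith-+-< xs< us≤

dot : ∀ {n} → Vec ℕ n → Vec ℕ n → ℕ
dot [] [] = 0
dot (c ∷ cs) (x ∷ xs) = c * x + dot cs xs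

dot-zipWith-+ : ∀ {n} (cs xs ys : Vec ℕ n) → dot cs (zipWith _+_ xs ys) ≡ dot cs xs + dot cs ys
dot-zipWith-+ [] [] [] = refl
dot-zipWith-+ (c ∷ cs) (x ∷ xs) (y ∷ ys) rewrite dot-zipWith-+ cs xs ys =
  regroup c x y (dot cs xs) (dot cs ys)
  where regroup : ∀ c x y a b → c * (x + y) + (a + b) ≡ c * x + a + (c * y + b)
        regroup = solve-∀

dot-replicate-0 : ∀ {n} (cs : Vec ℕ n) → dot cs (replicate n 0) ≡ 0
dot-replicate-0 [] = refl
dot-replicate-0 (c ∷ cs) rewrite *-zeroʳ c = dot-replicate-0 cs

dot-unitV : ∀ {n} (cs : Vec ℕ n) (k : Fin n) → dot cs (unitV n k) ≡ lookup cs k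
dot-unitV (c ∷ cs) F.zero rewrite dot-replicate-0 cs = trans (+-identityʳ (c * 1)) (*-identityʳ c)
dot-unitV (c ∷ cs) (F.suc k) rewrite *-zeroʳ c = dot-unitV cs k

lin : ∀ {n} → Point n → Point n → ℕ
lin (cs , c) (xs , z) = dot cs xs + c * z

lin-⊕ : ∀ {n} (c x y : Point n) → lin c (x ⊕ y) ≡ lin c x + lin c y
lin-⊕ (cs , c) (xs , z) (ys , u) rewrite dot-zipWith-+ cs xs ys =
  regroup (dot cs xs) (dot cs ys) c z u
  where regroup : ∀ a b c z u → a + b + c * (z + u) ≡ a + c * z + (b + c * u)
        regroup = solve-∀

lin-𝟎 : ∀ {n} (c : Point n) → lin c 𝟎 ≡ 0
lin-𝟎 (cs , c) = cong₂ _+_ (dot-replicate-0 cs) (*-zeroʳ c)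

lin-unitV : ∀ {n} (cs : Vec ℕ n) (c : ℕ) (k : Fin n) (j : ℕ) →
            lin (cs , c) (unitV n k , j) ≡ lookup cs k + c * j
lin-unitV cs c k j = cong (_+ c * j) (dot-unitV cs k)

Unique-lookup-injective : ∀ {A : Set} {xs : List A} → Unique xs →
                          ∀ {i j} → List.lookup xs i ≡ List.lookup xs j → i ≡ j
Unique-lookup-injective (x∉ ∷ u) {F.zero}  {F.zero}  eq = refl
Unique-lookup-injective (x∉ ∷ u) {F.zero}  {F.suc j} eq = ⊥-elim (AllL.lookup x∉ (∈-lookup j) eq)
Unique-lookup-injective (x∉ ∷ u) {F.suc i} {F.zero}  eq = ⊥-elim (AllL.lookup x∉ (∈-lookup i) (sym eq))
Unique-lookup-injective (x∉ ∷ u) {F.suc i} {F.suc j} eq = cong F.suc (Unique-lookup-injective u eq)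

Unique-length-≤ : ∀ {A : Set} {P : A → Set} {M} (code : ∀ {x} → P x → Fin M) →
                  (∀ {x y} (px : P x) (py : P y) → code px ≡ code py → x ≡ y) →
                  ∀ {xs} → Unique xs → All P xs → length xs ≤ M
Unique-length-≤ code code-inj u ps =
  Finₚ.injective⇒≤ λ eq → Unique-lookup-injective u (code-inj (at _) (at _) eq)
  where at = λ i → AllL.lookup ps (∈-lookup i)

Near : ∀ {n} → ℕ → Vec ℕ n → Vec ℕ n → Set
Near D c x = ∀ k → lookup x k < lookup c k + D × lookup c k < lookup x k + D

offset-< : ∀ {D c x} → x < c + D → c ≤ x + D → x + D ∸ c < 2 * D
offset-< {D} {c} {x} x<c+D c≤x+D = begin-strict
  x + D ∸ c        <⟨ ∸-monoˡ-< (+-monoˡ-< D x<c+D) c≤x+D ⟩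
  c + D + D ∸ c    ≡⟨ cong (_∸ c) (+-assoc c D D) ⟩
  c + (D + D) ∸ c  ≡⟨ m+n∸m≡n c (D + D) ⟩
  D + D            ≡⟨ cong (D +_) (+-identityʳ D) ⟨
  2 * D            ∎
  where open ≤-Reasoning

near-offset : ∀ {n} D (c x : Vec ℕ n) → Near D c x → Fin n → Fin (2 * D)
near-offset D c x near k = fromℕ< (offset-< (proj₁ (near k)) (<⇒≤ (proj₂ (near k))))

near-code : ∀ {n} D (c x : Vec ℕ n) → Near D c x → Fin ((2 * D) ^ n)
near-code D c x near = funToFin (near-offset D c x near)

near-code-injective : ∀ {n} D (c x y : Vec ℕ n) (nx : Near D c x) (ny : Near D c y) →
                      near-code D c x nx ≡ near-code D c y ny → x ≡ y
near-code-injective D c x y nx ny eq = begin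
  x                   ≡⟨ Vecₚ.tabulate∘lookup x ⟨
  tabulate (lookup x) ≡⟨ Vecₚ.tabulate-cong lookup-≡ ⟩
  tabulate (lookup y) ≡⟨ Vecₚ.tabulate∘lookup y ⟩
  y                   ∎
  where
    open ≡-Reasoning
    offset-≡ : ∀ k → near-offset D c x nx k ≡ near-offset D c y ny k
    offset-≡ k = begin
      near-offset D c x nx k                ≡⟨ Finₚ.finToFun-funToFin (near-offset D c x nx) k ⟨
      finToFun (near-code D c x nx) k       ≡⟨ cong (λ i → finToFun i k) eq ⟩
      finToFun (near-code D c y ny) k       ≡⟨ Finₚ.finToFun-funToFin (near-offset D c y ny) k ⟩
      near-offset D c y ny k                ∎
    lookup-≡ : ∀ k → lookup x k ≡ lookup y k
    lookup-≡ k = +-cancelʳ-≡ D _ _ (∸-cancelʳ-≡ (<⇒≤ (proj₂ (nx k))) (<⇒≤ (proj₂ (ny k)))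
      (trans (sym (Finₚ.toℕ-fromℕ< _)) (trans (cong toℕ (offset-≡ k)) (Finₚ.toℕ-fromℕ< _))))

[]=-exists : ∀ {A : Set} (xs : List A) {i} → i < length xs → ∃[ x ] xs [ i ]= x
[]=-exists (x ∷ xs) {zero} _ = x , here
[]=-exists (x ∷ xs) {suc i} i< with y , at ← []=-exists xs (≤-pred i<) = y , there at

[m+kn]%n≡m : ∀ {m} k n .{{_ : NonZero n}} → m < n → (m + k * n) % n ≡ m
[m+kn]%n≡m {m} k n m<n = trans (DivMod.[m+kn]%n≡m%n m k n) (DivMod.m<n⇒m%n≡m m<n)

[m+kn]/n≡k : ∀ {m} k n .{{_ : NonZero n}} → m < n → (m + k * n) / n ≡ k
[m+kn]/n≡k {m} k n m<n = begin
  (m + k * n) / n    ≡⟨ DivMod.+-distrib-/ m (k * n) remainders< ⟩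
  m / n + k * n / n  ≡⟨ cong₂ _+_ (DivMod.m<n⇒m/n≡0 m<n) (DivMod.m*n/n≡m k n) ⟩
  k                  ∎
  where
    open ≡-Reasoning
    remainders< : m % n + k * n % n < n
    remainders< = subst₂ (λ a b → a + b < n) (sym (DivMod.m<n⇒m%n≡m m<n)) (sym (DivMod.m*n%n≡0 k n))
                    (subst (_< n) (sym (+-identityʳ m)) m<n)

m<[1+m/n]*n : ∀ m n .{{_ : NonZero n}} → m < suc (m / n) * n
m<[1+m/n]*n m n = begin-strict
  m                  ≡⟨ DivMod.m≡m%n+[m/n]*n m n ⟩
  m % n + m / n * n  <⟨ +-monoˡ-< (m / n * n) (DivMod.m%n<n m n) ⟩
  suc (m / n) * n    ∎
  where open ≤-Reasoning

gap-straddles-block : ∀ L {S S′} .{{_ : NonZero L}} → S + 2 * L ≤ S′ →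
                      S < suc (S / L) * L × suc (suc (S / L)) * L ≤ S′
gap-straddles-block L {S} S+2L≤ = m<[1+m/n]*n S L , (begin
  suc (suc (S / L)) * L  ≡⟨ regroup (S / L) L ⟩
  S / L * L + 2 * L      ≤⟨ +-monoˡ-≤ (2 * L) (DivMod.m/n*n≤m S L) ⟩
  S + 2 * L              ≤⟨ S+2L≤ ⟩
  _                      ∎)
  where
    open ≤-Reasoning
    regroup : ∀ A L → suc (suc A) * L ≡ A * L + 2 * L
    regroup = solve-∀

1+2m<2n : ∀ {m n} → m < n → suc (2 * m) < 2 * n
1+2m<2n {m} {n} m<n = subst (_≤ 2 * n) (double-suc m) (*-monoʳ-≤ 2 m<n)
  where double-suc : ∀ m → 2 * suc m ≡ suc (suc (2 * m))
        double-suc = solve-∀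

2n<1+2m : ∀ {m n} → n ≤ m → 2 * n < suc (2 * m)
2n<1+2m n≤m = s≤s (*-monoʳ-≤ 2 n≤m)

rev-< : ∀ m i → rev m i < 2 ^ m
rev-< zero i = s≤s z≤n
rev-< (suc m) i = begin-strict
  (i % 2) * 2 ^ m + rev m (i / 2)
    <⟨ +-mono-≤-< (*-monoˡ-≤ (2 ^ m) (≤-pred (DivMod.m%n<n i 2))) (rev-< m (i / 2)) ⟩
  1 * 2 ^ m + 2 ^ m
    ≡⟨ double (2 ^ m) ⟩
  2 * 2 ^ m ∎
  where
    open ≤-Reasoning
    double : ∀ x → 1 * x + x ≡ 2 * x
    double = solve-∀

rev-bit : ∀ m {b} c → b < 2 → rev (suc m) (b + c * 2) ≡ b * 2 ^ m + rev m c
rev-bit m c b<2 = cong₂ (λ bit rest → bit * 2 ^ m + rev m rest) ([m+kn]%n≡m c 2 b<2) ([m+kn]/n≡k c 2 b<2)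

InBlock : ℕ → ℕ → ℕ → Set
InBlock L p x = p * L ≤ x × x < suc p * L

InBlock-shift : ∀ {L p x} a → InBlock L p x → InBlock L (a + p) (a * L + x)
InBlock-shift {L} {p} {x} a (lo , hi) =
  subst (_≤ a * L + x) (sym (*-distribʳ-+ L a p)) (+-monoʳ-≤ (a * L) lo) ,
  subst (a * L + x <_) (trans (sym (*-distribʳ-+ L a (suc p))) (cong (_* L) (+-suc a p))) (+-monoʳ-< (a * L) hi)

top-bit : ∀ j {p} → p < 2 ^ suc j → ∃[ b ] ∃[ p′ ] b < 2 × p′ < 2 ^ j × p ≡ b * 2 ^ j + p′
top-bit j {p} p< = p / 2 ^ j , p % 2 ^ j ,
  DivMod.m<n*o⇒m/o<n p< , DivMod.m%n<n p (2 ^ j) ,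
  trans (DivMod.m≡m%n+[m/n]*n p (2 ^ j)) (+-comm (p % 2 ^ j) _)
  where instance _ = m^n≢0 2 j

nearest-with-bit : ∀ {b} i → b < 2 → ∃[ c ] i ≤ b + c * 2 × b + c * 2 < 2 + i
nearest-with-bit {b} zero b<2 = 0 , z≤n , subst (_< 2) (sym (+-identityʳ b)) b<2
nearest-with-bit {b} (suc i) b<2 with nearest-with-bit i b<2
... | c , lo , hi with m≤n⇒m<n∨m≡n lo
...   | inj₁ i<  = c , i< , m≤n⇒m≤1+n hi
...   | inj₂ refl =
  suc c , subst (suc i ≤_) (sym (next b c)) (n≤1+n (suc i)) , subst (_< 3 + i) (sym (next b c)) ≤-refl
  where next : ∀ b c → b + suc c * 2 ≡ 2 + (b + c * 2)
        next = solve-∀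

rev-hits-block : ∀ j l i₀ {p} → p < 2 ^ j →
                 ∃[ o ] o < 2 ^ j × InBlock (2 ^ l) p (rev (j + l) (i₀ + o))
rev-hits-block zero l i₀ {zero} _ =
  0 , s≤s z≤n , z≤n , subst (rev l (i₀ + 0) <_) (sym (+-identityʳ (2 ^ l))) (rev-< l (i₀ + 0))
rev-hits-block zero l i₀ {suc p} (s≤s ())
rev-hits-block (suc j) l i₀ p< with top-bit j p<
... | b , p′ , b<2 , p′< , refl with nearest-with-bit i₀ b<2
... | c , lo , hi with rev-hits-block j l c p′<
... | o′ , o′< , block =
  e + o′ * 2 , offset< , subst (InBlock (2 ^ l) (b * 2 ^ j + p′)) (sym rev-index) (InBlock-shift (b * 2 ^ j) block)
  where
    open ≤-Reasoning
    e = b + c * 2 ∸ i₀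
    e<2 : e < 2
    e<2 = m<n+o⇒m∸n<o (b + c * 2) i₀ (subst (b + c * 2 <_) (+-comm 2 i₀) hi)
    offset< : e + o′ * 2 < 2 ^ suc j
    offset< = begin-strict
      e + o′ * 2  <⟨ +-monoˡ-< (o′ * 2) e<2 ⟩
      suc o′ * 2  ≤⟨ *-monoˡ-≤ 2 o′< ⟩
      2 ^ j * 2   ≡⟨ *-comm (2 ^ j) 2 ⟩
      2 ^ suc j   ∎
    rev-index : rev (suc j + l) (i₀ + (e + o′ * 2)) ≡ b * 2 ^ j * 2 ^ l + rev (j + l) (c + o′)
    rev-index = begin-equality
      rev (suc (j + l)) (i₀ + (e + o′ * 2))  ≡⟨ cong (rev (suc (j + l))) index ⟩
      rev (suc (j + l)) (b + (c + o′) * 2)   ≡⟨ rev-bit (j + l) (c + o′) b<2 ⟩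
      b * 2 ^ (j + l) + R                    ≡⟨ cong (λ x → b * x + R) (^-distribˡ-+-* 2 j l) ⟩
      b * (2 ^ j * 2 ^ l) + R                ≡⟨ cong (_+ R) (*-assoc b (2 ^ j) (2 ^ l)) ⟨
      b * 2 ^ j * 2 ^ l + R                  ∎
      where
        R = rev (j + l) (c + o′)
        index : i₀ + (e + o′ * 2) ≡ b + (c + o′) * 2
        index = begin-equality
          i₀ + (e + o′ * 2)        ≡⟨ +-assoc i₀ e (o′ * 2) ⟨
          i₀ + e + o′ * 2          ≡⟨ cong (_+ o′ * 2) (m+[n∸m]≡n lo) ⟩
          b + c * 2 + o′ * 2       ≡⟨ regroup b c o′ ⟩
          b + (c + o′) * 2         ∎
          where regroup : ∀ b c o → b + c * 2 + o * 2 ≡ b + (c + o) * 2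
                regroup = solve-∀

scale-for : ∀ d g m → g ≤ d * 2 ^ m →
            ∃[ j ] ∃[ l ] j + l ≡ m × (j ≡ 0 ⊎ 2 ^ suc j * d ≤ g) × g ≤ 2 ^ (2 + j) * d
scale-for d g zero g≤ =
  0 , 0 , refl , inj₁ refl , ≤-trans g≤ (≤-trans (≤-reflexive (*-comm d 1)) (*-monoˡ-≤ d {1} {4} (s≤s z≤n)))
scale-for d g (suc m) g≤ with g ≤? d * 2 ^ m
... | yes g≤′ with scale-for d g m g≤′
...   | j , l , refl , lower , upper = j , suc l , +-suc j l , lower , upper
scale-for d g (suc zero) g≤ | no _ =
  0 , 1 , refl , inj₁ refl ,
  ≤-trans g≤ (≤-trans (≤-reflexive (*-comm d 2)) (*-monoˡ-≤ d {2} {4} (s≤s (s≤s z≤n))))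
scale-for d g (suc (suc m)) g≤ | no g≰ =
  m , 2 , +-comm m 2 ,
  inj₂ (subst (_≤ g) (*-comm d (2 ^ suc m)) (<⇒≤ (≰⇒> g≰))) , subst (g ≤_) (*-comm d (2 ^ (2 + m))) g≤

^-distribʳ-* : ∀ x y n → (x * y) ^ n ≡ x ^ n * y ^ n
^-distribʳ-* x y zero = refl
^-distribʳ-* x y (suc n) rewrite ^-distribʳ-* x y n = interchange x y (x ^ n) (y ^ n)
  where interchange : ∀ x y a b → x * y * (a * b) ≡ x * a * (y * b)
        interchange = solve-∀

[m+n]⊖[o+p]≡[m⊖o]+[n⊖p] : ∀ m n o p → (m + n) ⊖ (o + p) ≡ (m ⊖ o) ℤ.+ (n ⊖ p)
[m+n]⊖[o+p]≡[m⊖o]+[n⊖p] m n o p = begin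
  (m + n) ⊖ (o + p)                        ≡⟨ ℤₚ.m-n≡m⊖n (m + n) (o + p) ⟨
  ℤ.+ (m + n) ℤ.- ℤ.+ (o + p)              ≡⟨ cong₂ ℤ._-_ (ℤₚ.pos-+ m n) (ℤₚ.pos-+ o p) ⟩
  (ℤ.+ m ℤ.+ ℤ.+ n) ℤ.- (ℤ.+ o ℤ.+ ℤ.+ p)  ≡⟨ interchange (ℤ.+ m) (ℤ.+ n) (ℤ.+ o) (ℤ.+ p) ⟩
  (ℤ.+ m ℤ.- ℤ.+ o) ℤ.+ (ℤ.+ n ℤ.- ℤ.+ p)  ≡⟨ cong₂ ℤ._+_ (ℤₚ.m-n≡m⊖n m o) (ℤₚ.m-n≡m⊖n n p) ⟩
  (m ⊖ o) ℤ.+ (n ⊖ p)                      ∎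
  where
    open ≡-Reasoning
    interchange : ∀ a b c e → (a ℤ.+ b) ℤ.- (c ℤ.+ e) ≡ (a ℤ.- c) ℤ.+ (b ℤ.- e)
    interchange = ℤSolver.solve-∀

module CriticalPaths (d : ℕ) .{{_ : NonZero d}} (m : ℕ) where
  open Construction d m

  InT-w⇒< : ∀ {s t} → InT s (w t) → q (t / d) < lookup s (t mod d)
  InT-w⇒< {s} {t} (k , j , j< , eq) =
    subst₂ (λ x k′ → x < lookup s k′) (sym (cong proj₂ eq)) (sym (unitV-injective d (cong proj₁ eq))) j<

  <⇒InT-w : ∀ {s t} → q (t / d) < lookup s (t mod d) → InT s (w t)
  <⇒InT-w {s} {t} q< = t mod d , q (t / d) , q< , refl

  InT-w? : ∀ s t → Dec (InT s (w t))
  InT-w? s t = map′ (<⇒InT-w {s}) (InT-w⇒< {s}) (q (t / d) <? lookup s (t mod d))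

  critStep : Vec ℕ d → ℕ → Point d
  critStep s t with InT-w? s t
  ... | yes _ = w t
  ... | no  _ = 𝟎

  critStep-edge : ∀ s t → critStep s t ≡ w t ⊎ critStep s t ≡ 𝟎
  critStep-edge s t with InT-w? s t
  ... | yes _ = inj₁ refl
  ... | no  _ = inj₂ refl

  critStep-rule : ∀ s t {x y} → (InT s (w t) → y ≡ x ⊕ w t) → (¬ InT s (w t) → y ≡ x ⊕ 𝟎) →
                  y ≡ x ⊕ critStep s t
  critStep-rule s t taken skipped with InT-w? s t
  ... | yes i = taken i
  ... | no ¬i = skipped ¬i

  critStep-cong : ∀ {s s′ t} → critStep s t ≡ critStep s′ t → InT s′ (w t) → InT s (w t)
  critStep-cong {s} {s′} {t} eq i′ with InT-w? s t | InT-w? s′ t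
  ... | yes i | _     = i
  ... | no  _ | yes _ = ⊥-elim (unitV≢0 d (t mod d) (cong proj₁ (sym eq)))
  ... | no  _ | no ¬i′ = ⊥-elim (¬i′ i′)

  height : Point d → ℕ
  height = lin (replicate d 1 , 2)

  weight : Vec ℕ d → Point d → ℕ
  weight s = lin (map (2 *_) s , 0)

  Φ : Vec ℕ d → Point d → ℤ
  Φ s x = height x ⊖ weight s x

  Φ-⊕ : ∀ s x y → Φ s (x ⊕ y) ≡ Φ s x ℤ.+ Φ s y
  Φ-⊕ s x y rewrite lin-⊕ (replicate d 1 , 2) x y | lin-⊕ (map (2 *_) s , 0) x y =
    [m+n]⊖[o+p]≡[m⊖o]+[n⊖p] (height x) (height y) (weight s x) (weight s y)

  Φ-𝟎 : ∀ s → Φ s 𝟎 ≡ 0ℤ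
  Φ-𝟎 s rewrite lin-𝟎 (replicate d 1 , 2) | lin-𝟎 (map (2 *_) s , 0) = refl

  Φ-w : ∀ s t → Φ s (w t) ≡ suc (2 * q (t / d)) ⊖ 2 * lookup s (t mod d)
  Φ-w s t = cong₂ _⊖_
    (trans (lin-unitV (replicate d 1) 2 k (q (t / d))) (cong (_+ 2 * q (t / d)) (Vecₚ.lookup-replicate k 1)))
    (trans (lin-unitV (map (2 *_) s) 0 k (q (t / d))) (trans (+-identityʳ _) (Vecₚ.lookup-map k (2 *_) s)))
    where k = t mod d

  critStep-minimal : ∀ s t {v} → v ≡ w t ⊎ v ≡ 𝟎 → v ≡ critStep s t ⊎ Φ s (critStep s t) ℤ.< Φ s v
  critStep-minimal s t edge with InT-w? s t | edge
  ... | yes _ | inj₁ refl = inj₁ refl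
  ... | no  _ | inj₂ refl = inj₁ refl
  ... | yes i | inj₂ refl = inj₂ (begin-strict
    Φ s (w t)                  ≡⟨ Φ-w s t ⟩
    suc (2 * Q) ⊖ 2 * S        <⟨ ℤₚ.⊖-monoˡ-< (2 * S) (1+2m<2n (InT-w⇒< {s} i)) ⟩
    2 * S ⊖ 2 * S              ≡⟨ ℤₚ.n⊖n≡0 (2 * S) ⟩
    0ℤ                         ≡⟨ Φ-𝟎 s ⟨
    Φ s 𝟎                      ∎)
    where
      open ℤₚ.≤-Reasoning
      Q = q (t / d)
      S = lookup s (t mod d)
  ... | no ¬i | inj₁ refl = inj₂ (begin-strict
    Φ s 𝟎                      ≡⟨ Φ-𝟎 s ⟩
    0ℤ                         ≡⟨ ℤₚ.n⊖n≡0 (2 * S) ⟨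
    2 * S ⊖ 2 * S              <⟨ ℤₚ.⊖-monoˡ-< (2 * S) (2n<1+2m (≮⇒≥ (¬i ∘ <⇒InT-w {s}))) ⟩
    suc (2 * Q) ⊖ 2 * S        ≡⟨ Φ-w s t ⟨
    Φ s (w t)                  ∎)
    where
      open ℤₚ.≤-Reasoning
      Q = q (t / d)
      S = lookup s (t mod d)

  crit-layer-≤ : ∀ {s t π} → CritFrom s t π → t ≤ d * r
  crit-layer-≤ (end t≡) = ≤-reflexive t≡
  crit-layer-≤ (step _ _ c) = <⇒≤ (crit-layer-≤ c)

  path-layer-≤ : ∀ {t π} → IsPathFrom t π → t ≤ d * r
  path-layer-≤ (single t≤ _) = t≤
  path-layer-≤ (cons _ _ p) = <⇒≤ (path-layer-≤ p)

  crit-length : ∀ {s t x ps} → CritFrom s t (x ∷ ps) → t + length ps ≡ d * r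
  crit-length {t = t} (end t≡) = trans (+-identityʳ t) t≡
  crit-length {t = t} (step _ _ c) = trans (+-suc t _) (crit-length c)

  crit-deterministic : ∀ {s t x ps ps′} → CritFrom s t (x ∷ ps) → CritFrom s t (x ∷ ps′) → ps ≡ ps′
  crit-deterministic (end _) (end _) = refl
  crit-deterministic (end t≡) (step _ _ c) = ⊥-elim (<-irrefl t≡ (crit-layer-≤ c))
  crit-deterministic (step _ _ c) (end t≡) = ⊥-elim (<-irrefl t≡ (crit-layer-≤ c))
  crit-deterministic {s} {t} (step taken skipped c) (step taken′ skipped′ c′)
    with refl ← trans (critStep-rule s t taken skipped) (sym (critStep-rule s t taken′ skipped′))
    = cong (_ ∷_) (crit-deterministic c c′)

  crit-meet : ∀ {s t π π′ i p} → CritFrom s t π → CritFrom s t π′ →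
              π [ i ]= p → π′ [ i ]= p → π ≡ π′
  crit-meet c c′ here here = cong (_ ∷_) (crit-deterministic c c′)
  crit-meet {s} {t} (step {x = x} taken skipped c) (step {x = x′} taken′ skipped′ c′) (there i) (there i′)
    with crit-meet c c′ i i′
  ... | refl with refl ← ⊕-cancelʳ x x′ (critStep s t)
                           (trans (sym (critStep-rule s t taken skipped)) (critStep-rule s t taken′ skipped′))
    = refl

  crit-step-at : ∀ {s t π} i {p p′} → CritFrom s t π → π [ i ]= p → π [ suc i ]= p′ →
                 p′ ≡ p ⊕ critStep s (t + i)
  crit-step-at {s} {t} zero {p} {p′} (step taken skipped _) here (there here) =
    subst (λ t′ → p′ ≡ p ⊕ critStep s t′) (sym (+-identityʳ t)) (critStep-rule s t taken skipped)
  crit-step-at {s} {t} (suc i) {p} {p′} (step _ _ c) (there at) (there at′) =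
    subst (λ t′ → p′ ≡ p ⊕ critStep s t′) (sym (+-suc t i)) (crit-step-at i c at at′)

  Bounded : ℕ → Point d → Set
  Bounded t (xs , z) = VecAll (_< r + t) xs × z < r * r + t * r

  InStart⇒Bounded : ∀ {x} → InStart x → Bounded 0 x
  InStart⇒Bounded {xs , z} (xs< , z<) =
    VecAll.map (subst (_ <_) (sym (+-identityʳ r))) xs< , subst (z <_) (sym (+-identityʳ (r * r))) z<

  Bounded⇒InVBox : ∀ {t x} → t ≤ d * r → Bounded t x → InVBox x
  Bounded⇒InVBox {t} {xs , z} t≤ (xs< , z<) =
    VecAll.map (λ x< → <-≤-trans x< (≤-trans (+-mono-≤ (m≤n*m r d) t≤) (≤-reflexive (twice d r)))) xs< ,
    <-≤-trans z< (≤-trans (+-mono-≤ (*-monoˡ-≤ r (m≤n*m r d)) (*-monoˡ-≤ r t≤))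
                           (≤-reflexive (twice-r d r)))
    where
      twice : ∀ d r → d * r + d * r ≡ 2 * d * r
      twice = solve-∀
      twice-r : ∀ d r → d * r * r + d * r * r ≡ 2 * d * r * r
      twice-r = solve-∀

  Bounded-step : ∀ {t xs z us u} → Bounded t (xs , z) → VecAll (_≤ 1) us → u < r →
                 Bounded (suc t) ((xs , z) ⊕ (us , u))
  Bounded-step {t} {xs} {z} {us} {u} (xs< , z<) us≤ u< =
    subst (λ B → VecAll (_< B) (zipWith _+_ xs us)) (sym (+-suc r t)) (zipWith-+-< xs< us≤) ,
    subst (z + u <_) (regroup (r * r) (t * r) r) (+-mono-< z< u<)
    where regroup : ∀ a b c → a + b + c ≡ a + (c + b)
          regroup = solve-∀

  critStep-bounds : ∀ {s} → InTuple s → ∀ t →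
                    VecAll (_≤ 1) (proj₁ (critStep s t)) × proj₂ (critStep s t) < r
  critStep-bounds {s} tuple t with InT-w? s t
  ... | yes i = unitV-≤1 d (t mod d) , <-≤-trans (InT-w⇒< {s} i) (proj₂ (VecAllₚ.lookup⁺ tuple (t mod d)))
  ... | no  _ = replicate-≤ d z≤n , m^n>0 2 m

  CritFrom⇒IsPathFrom : ∀ {s t x ps} → InTuple s → CritFrom s t (x ∷ ps) → Bounded t x →
                        IsPathFrom t (x ∷ ps)
  CritFrom⇒IsPathFrom tuple (end t≡) bounded =
    single (≤-reflexive t≡) (Bounded⇒InVBox (≤-reflexive t≡) bounded)
  CritFrom⇒IsPathFrom {s} {t} {x} tuple (step taken skipped c) bounded =
    cons (Bounded⇒InVBox (<⇒≤ (crit-layer-≤ c)) bounded) edge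
         (CritFrom⇒IsPathFrom tuple c (subst (Bounded (suc t)) (sym y≡) next))
    where
      y≡ = critStep-rule s t taken skipped
      next = Bounded-step bounded (proj₁ (critStep-bounds tuple t)) (proj₂ (critStep-bounds tuple t))
      edge = Sum.map (trans y≡ ∘ cong (x ⊕_)) (trans y≡ ∘ cong (x ⊕_)) (critStep-edge s t)

  edge-vector : ∀ {t x y} → y ≡ x ⊕ w t ⊎ y ≡ x ⊕ 𝟎 → ∃[ v ] (v ≡ w t ⊎ v ≡ 𝟎) × y ≡ x ⊕ v
  edge-vector (inj₁ y≡) = _ , inj₁ refl , y≡
  edge-vector (inj₂ y≡) = _ , inj₂ refl , y≡

  Φ-telescope : ∀ s {x y} e v → y ≡ x ⊕ v → Φ s e ℤ.- Φ s x ≡ Φ s v ℤ.+ (Φ s e ℤ.- Φ s y)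
  Φ-telescope s {x} e v refl rewrite Φ-⊕ s x v = telescope (Φ s e) (Φ s x) (Φ s v)
    where telescope : ∀ e x v → e ℤ.- x ≡ v ℤ.+ (e ℤ.- (x ℤ.+ v))
          telescope = ℤSolver.solve-∀

  crit-optimal : ∀ {s t x x′ ps ps′ i e e′} → CritFrom s t (x ∷ ps) → IsPathFrom t (x′ ∷ ps′) →
                 (x ∷ ps) [ i ]= e → (x′ ∷ ps′) [ i ]= e′ → Φ s e ℤ.- Φ s x ℤ.≤ Φ s e′ ℤ.- Φ s x′
  crit-optimal {s} {x = x} {x′} _ _ here here =
    ℤₚ.≤-reflexive (trans (ℤₚ.+-inverseʳ (Φ s x)) (sym (ℤₚ.+-inverseʳ (Φ s x′))))
  crit-optimal {s} {t} {x} {x′} {e = e} {e′}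
               (step {y = y} taken skipped c) (cons {y = y′} _ edge p) (there at) (there at′)
    with v , v-edge , y′≡ ← edge-vector edge = begin
      Φ s e ℤ.- Φ s x
        ≡⟨ Φ-telescope s e (critStep s t) (critStep-rule s t taken skipped) ⟩
      Φ s (critStep s t) ℤ.+ (Φ s e ℤ.- Φ s y)
        ≤⟨ ℤₚ.+-mono-≤ (critStep-≤ (critStep-minimal s t v-edge)) (crit-optimal c p at at′) ⟩
      Φ s v ℤ.+ (Φ s e′ ℤ.- Φ s y′)
        ≡⟨ Φ-telescope s e′ v y′≡ ⟨
      Φ s e′ ℤ.- Φ s x′ ∎
    where
      open ℤₚ.≤-Reasoning
      critStep-≤ : v ≡ critStep s t ⊎ Φ s (critStep s t) ℤ.< Φ s v → Φ s (critStep s t) ℤ.≤ Φ s v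
      critStep-≤ (inj₁ refl) = ℤₚ.≤-refl
      critStep-≤ (inj₂ Φ<) = ℤₚ.<⇒≤ Φ<

  crit-unique : ∀ {s t x ps ps′ e} → CritFrom s t (x ∷ ps) → IsPathFrom t (x ∷ ps′) →
                (x ∷ ps) [ length ps ]= e → (x ∷ ps′) [ length ps ]= e → ps′ ≡ ps
  crit-unique (end _) (single _ _) here here = refl
  crit-unique (end t≡) (cons _ _ p) here here = ⊥-elim (<-irrefl t≡ (path-layer-≤ p))
  crit-unique {s} {t} {x} {e = e}
              (step {y = y} taken skipped c) (cons {y = y′} _ edge p) (there at) (there at′)
    with v , v-edge , y′≡ ← edge-vector edge | critStep-minimal s t v-edge
  ... | inj₁ refl with refl ← trans y′≡ (sym (critStep-rule s t taken skipped)) =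
    cong (y ∷_) (crit-unique c p at at′)
  ... | inj₂ Φc<Φv = ⊥-elim (ℤₚ.<-irrefl refl (begin-strict
      Φ s e ℤ.- Φ s x
        ≡⟨ Φ-telescope s e (critStep s t) (critStep-rule s t taken skipped) ⟩
      Φ s (critStep s t) ℤ.+ (Φ s e ℤ.- Φ s y)
        <⟨ ℤₚ.+-mono-<-≤ Φc<Φv (crit-optimal c p at at′) ⟩
      Φ s v ℤ.+ (Φ s e ℤ.- Φ s y′)
        ≡⟨ Φ-telescope s e v y′≡ ⟨
      Φ s e ℤ.- Φ s x ∎))
    where open ℤₚ.≤-Reasoning

  CritPath-unique : ∀ {x s π} → CritPath x s π →
                    (π′ : List (Point d)) → IsPathFrom 0 π′ → (u v : Point d) →
                    π [ 0 ]= u → π [ d * r ]= v → π′ [ 0 ]= u → π′ [ d * r ]= v → π′ ≡ π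
  CritPath-unique {π = x ∷ ps} (_ , _ , _ , c) (.x ∷ ps′) p .x v here at here at′ =
    cong (x ∷_) (crit-unique c p (at-end ps at) (at-end ps′ at′))
    where
      at-end : ∀ qs → (x ∷ qs) [ d * r ]= v → (x ∷ qs) [ length ps ]= v
      at-end qs = subst (λ i → (x ∷ qs) [ i ]= v) (sym (crit-length c))

  layer : ℕ → Fin d → ℕ
  layer i k = toℕ k + i * d

  layer-/ : ∀ i k → layer i k / d ≡ i
  layer-/ i k = [m+kn]/n≡k i d (Finₚ.toℕ<n k)

  layer-mod : ∀ i k → layer i k mod d ≡ k
  layer-mod i k = Finₚ.toℕ-injective (trans (Finₚ.toℕ-fromℕ< _) ([m+kn]%n≡m i d (Finₚ.toℕ<n k)))

  layer-in-window : ∀ a g {j o} (k : Fin d) → 2 ^ suc j * d ≤ g → o < 2 ^ j →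
                    a ≤ layer (suc (a / d) + o) k × layer (suc (a / d) + o) k < a + g
  layer-in-window a g {j} {o} k window o< = lower , upper
    where
      open ≤-Reasoning
      i₀ = suc (a / d)
      lower : a ≤ layer (i₀ + o) k
      lower = begin
        a                     ≤⟨ <⇒≤ (m<[1+m/n]*n a d) ⟩
        i₀ * d                ≤⟨ *-monoˡ-≤ d (m≤m+n i₀ o) ⟩
        (i₀ + o) * d          ≤⟨ m≤n+m _ (toℕ k) ⟩
        layer (i₀ + o) k      ∎
      upper : layer (i₀ + o) k < a + g
      upper = begin-strict
        toℕ k + (i₀ + o) * d              <⟨ +-monoˡ-< _ (Finₚ.toℕ<n k) ⟩
        d + (i₀ + o) * d                  ≡⟨ regroup (a / d) o d ⟩
        a / d * d + (d + suc o * d)       ≤⟨ +-mono-≤ (DivMod.m/n*n≤m a d) (+-monoʳ-≤ d (*-monoˡ-≤ d o<)) ⟩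
        a + (d + 2 ^ j * d)               ≤⟨ +-monoʳ-≤ a (+-monoˡ-≤ _ (m≤n*m d (2 ^ j) {{m^n≢0 2 j}})) ⟩
        a + (2 ^ j * d + 2 ^ j * d)       ≡⟨ cong (a +_) (double (2 ^ j) d) ⟩
        a + 2 ^ suc j * d                 ≤⟨ +-monoʳ-≤ a window ⟩
        a + g                             ∎
        where
          regroup : ∀ A o d → d + (suc A + o) * d ≡ A * d + (d + suc o * d)
          regroup = solve-∀
          double : ∀ P d → P * d + P * d ≡ 2 * P * d
          double = solve-∀

  Agree : Vec ℕ d → Vec ℕ d → ℕ → ℕ → Set
  Agree s s′ a g = ∀ t → a ≤ t → t < a + g → critStep s t ≡ critStep s′ t

  Agree⇒close : ∀ {s s′ a g j l} → InTuple s′ → Agree s s′ a g →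
                j + l ≡ m → j ≡ 0 ⊎ 2 ^ suc j * d ≤ g →
                ∀ k → lookup s′ k < lookup s k + 2 ^ suc l
  Agree⇒close {s} {s′} {a} {g} {j} {l} tuple agree jl scale k with lookup s′ k <? lookup s k + 2 ^ suc l
  ... | yes close = close
  ... | no far = ⊥-elim (separated scale)
    where
      instance _ = m^n≢0 2 l
      L = 2 ^ l
      S = lookup s k
      p = suc (S / L)
      straddle = gap-straddles-block L (≮⇒≥ far)
      r≡ : r ≡ 2 ^ j * L
      r≡ = trans (cong (2 ^_) (sym jl)) (^-distribˡ-+-* 2 j l)
      p<2^j : p < 2 ^ j
      p<2^j = *-cancelʳ-≤ (suc p) (2 ^ j) L
        (≤-trans (proj₂ straddle) (≤-trans (proj₂ (VecAllₚ.lookup⁺ tuple k)) (≤-reflexive r≡)))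
      separated : j ≡ 0 ⊎ 2 ^ suc j * d ≤ g → ⊥
      separated (inj₁ refl) with p<2^j
      ... | s≤s ()
      separated (inj₂ window) with rev-hits-block j l (suc (a / d)) p<2^j
      ... | o , o< , pL≤ , <[1+p]L = <-asym (proj₁ straddle) (≤-<-trans pL≤ (subst (_< S) q≡ q<S))
        where
          t = layer (suc (a / d) + o) k
          q≡ : q (t / d) ≡ rev (j + l) (suc (a / d) + o)
          q≡ = cong₂ rev (sym jl) (layer-/ (suc (a / d) + o) k)
          q<S′ : q (t / d) < lookup s′ (t mod d)
          q<S′ = subst (λ k′ → q (t / d) < lookup s′ k′) (sym (layer-mod (suc (a / d) + o) k))
                   (<-≤-trans (subst (_< suc p * L) (sym q≡) <[1+p]L) (proj₂ straddle))
          q<S : q (t / d) < S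
          q<S = subst (λ k′ → q (t / d) < lookup s k′) (layer-mod (suc (a / d) + o) k)
                  (InT-w⇒< {s} (critStep-cong (agree t t≥a t<a+g) (<⇒InT-w {s′} q<S′)))
            where
              t≥a = proj₁ (layer-in-window a g {j} k window o<)
              t<a+g = proj₂ (layer-in-window a g {j} k window o<)

  subpath-agree : ∀ {a σ₀ σs s s′ π π′} → CritFrom s 0 π → CritFrom s′ 0 π′ →
                  SubpathAt a (σ₀ ∷ σs) π → SubpathAt a (σ₀ ∷ σs) π′ → Agree s s′ a (length σs)
  subpath-agree {a} {σ₀} {σs} {s} {s′} c c′ sub sub′ t a≤t t<a+g =
    subst (λ t → critStep s t ≡ critStep s′ t) (m+[n∸m]≡n a≤t)
          (⊕-cancelˡ p _ _ (trans (sym (step-of c sub)) (step-of c′ sub′)))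
    where
      t′ = t ∸ a
      t′<g : t′ < length σs
      t′<g = +-cancelˡ-< a t′ (length σs) (subst (_< a + length σs) (sym (m+[n∸m]≡n a≤t)) t<a+g)
      σ-at = []=-exists (σ₀ ∷ σs) (m<n⇒m<1+n t′<g)
      σ-at′ = []=-exists (σ₀ ∷ σs) (s≤s t′<g)
      p = proj₁ σ-at
      p′ = proj₁ σ-at′
      step-of : ∀ {s π} → CritFrom s 0 π → SubpathAt a (σ₀ ∷ σs) π → p′ ≡ p ⊕ critStep s (a + t′)
      step-of {π = π} c sub = crit-step-at (a + t′) c (sub t′ p (proj₂ σ-at))
        (subst (λ i → π [ i ]= p′) (+-suc a t′) (sub (suc t′) p′ (proj₂ σ-at′)))

  tupleOf : ∀ {π} → InP π → Vec ℕ d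
  tupleOf (_ , s , _) = s

  count-containing : ∀ {a σ₀ σs j l} → j + l ≡ m → j ≡ 0 ⊎ 2 ^ suc j * d ≤ length σs →
                     ∀ {L} → Unique L → All (λ π → InP π × SubpathAt a (σ₀ ∷ σs) π) L →
                     length L ≤ (2 * 2 ^ suc l) ^ d
  count-containing jl scale u [] = z≤n
  count-containing {a} {σ₀} {σs} {j} {l} jl scale u contain@(((_ , s₀ , _ , tuple₀ , _ , c₀) , sub₀) ∷ _) =
    Unique-length-≤ code code-injective u contain
    where
      D = 2 ^ suc l
      Containing = λ π → InP π × SubpathAt a (σ₀ ∷ σs) π
      near : ∀ {π} (member : Containing π) → Near D s₀ (tupleOf (proj₁ member))
      near ((_ , s , _ , tuple , _ , c) , sub) k =
        Agree⇒close tuple (subpath-agree c₀ c sub₀ sub) jl scale k ,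
        Agree⇒close tuple₀ (subpath-agree c c₀ sub sub₀) jl scale k
      code : ∀ {π} → Containing π → Fin ((2 * D) ^ d)
      code member = near-code D s₀ (tupleOf (proj₁ member)) (near member)
      code-injective : ∀ {π π′} (member : Containing π) (member′ : Containing π′) →
                       code member ≡ code member′ → π ≡ π′
      code-injective member@((_ , s , _ , _ , _ , c) , sub) member′@((_ , s′ , _ , _ , _ , c′) , sub′) eq
        with refl ← near-code-injective D s₀ s s′ (near member) (near member′) eq =
        crit-meet c c′ (sub 0 σ₀ here) (sub′ 0 σ₀ here)

  path-length : ∀ {t x ps} → IsPathFrom t (x ∷ ps) → t + length ps ≤ d * r
  path-length {t} (single t≤ _) = subst (_≤ d * r) (sym (+-identityʳ t)) t≤
  path-length {t} (cons _ _ p) = subst (_≤ d * r) (sym (+-suc t _)) (path-length p)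

  containing-bound : ∀ a σ → IsPathFrom a σ → (L : List (List (Point d))) → Unique L →
                     All (λ π → InP π × SubpathAt a σ π) L →
                     length L * (length σ ∸ 1) ^ d ≤ (16 * d) ^ d * r ^ d
  containing-bound a (σ₀ ∷ σs) σ-path L u contain
    with j , l , jl , scale , g≤ ← scale-for d (length σs) m (≤-trans (m≤n+m _ a) (path-length σ-path)) = begin
      length L * length σs ^ d
        ≤⟨ *-mono-≤ (count-containing jl scale u contain) (^-monoˡ-≤ d g≤) ⟩
      (2 * 2 ^ suc l) ^ d * (2 ^ (2 + j) * d) ^ d     ≡⟨ ^-distribʳ-* (2 * 2 ^ suc l) (2 ^ (2 + j) * d) d ⟨
      (2 * 2 ^ suc l * (2 ^ (2 + j) * d)) ^ d         ≡⟨ cong (_^ d) (regroup (2 ^ j) (2 ^ l) d) ⟩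
      (16 * d * (2 ^ j * 2 ^ l)) ^ d                  ≡⟨ cong (λ x → (16 * d * x) ^ d) r≡ ⟨
      (16 * d * r) ^ d                                ≡⟨ ^-distribʳ-* (16 * d) r d ⟩
      (16 * d) ^ d * r ^ d                            ∎
    where
      open ≤-Reasoning
      r≡ : r ≡ 2 ^ j * 2 ^ l
      r≡ = trans (cong (2 ^_) (sym jl)) (^-distribˡ-+-* 2 j l)
      regroup : ∀ J L d → 2 * (2 * L) * (2 * (2 * J) * d) ≡ 16 * d * (J * L)
      regroup = solve-∀

proposition5p1 : (d : ℕ) .{{_ : NonZero d}} →
    Σ ℕ λ K → (m : ℕ) → let open Construction d m in
      ((x : Point d) (s : Vec ℕ d) (π : List (Point d)) → CritPath x s π →
        IsPathFrom 0 π ×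
        ((π' : List (Point d)) → IsPathFrom 0 π' → (u v : Point d) →
          π [ 0 ]= u → π [ d * r ]= v → π' [ 0 ]= u → π' [ d * r ]= v → π' ≡ π))
      ×
      ((x x' : Point d) (s : Vec ℕ d) (π π' : List (Point d)) →
        CritPath x s π → CritPath x' s π' → ¬ (π ≡ π') → VertexDisjoint π π')
      ×
      ((a : ℕ) (σ : List (Point d)) → IsPathFrom a σ → 1 ≤ length σ ∸ 1 →
        (L : List (List (Point d))) → Unique L →
        All (λ π → InP π × SubpathAt a σ π) L →
        length L * (length σ ∸ 1) ^ d ≤ K * r ^ d)
proposition5p1 d = (16 * d) ^ d , λ m → let open CriticalPaths d m in
  (λ { x s (.x ∷ ps) crit@(start , tuple , here , c) →
         CritFrom⇒IsPathFrom tuple c (InStart⇒Bounded start) , CritPath-unique crit }) ,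
  (λ { _ _ _ _ _ (_ , _ , _ , c) (_ , _ , _ , c′) π≢π′ i p at at′ → π≢π′ (crit-meet c c′ at at′) }) ,
  (λ a σ σ-path _ → containing-bound a σ σ-path)
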